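{- Let $G$ be a block graph. Then $\mathcal{P}(G)\neq\emptyset$ if and only if $G$ is non-elementary.
   Context: Graphs are simple and connected; $d$ is the shortest-path distance. A block graph is a graph obtained by starting with a complete graph $K_{n_1}$, $n_1\ge2$, and repeatedly (finitely many times, at least once) adding a complete graph $K_{n_i}$, $n_i\ge2$, identifying one of its vertices with one vertex of the graph built so far (equivalently, a finite connected graph whose blocks are all complete). It is non-elementary if it is neither a complete graph nor a path. For a vertex $v$ and positive integer $m$, $S(v,m)=\{w: d(v,w)=m\}$. A vertex separator is a set of vertices whose removal disconnects $G$. For distinct $v,v'$, a common separating subset of their $m$-spheres is a set $S\subseteq S(v,m)\cap S(v',m)$ which is a vertex separator such that some connected component of $G\setminus S$ contains neither $v$ nor $v'$. $\mathcal{P}(G)$ is the set of ordered pairs of distinct vertices $(v,v')$ such that for some positive integer $m$ their $m$-spheres have a common separating subset. -}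

module Defs where

open import Data.Nat using (ℕ; zero; suc; _+_; _<_; _≤_)
open import Data.Nat.Base using (_≡ᵇ_)
open import Data.Bool using (Bool; true; false; not; _∨_)
open import Data.Fin using (Fin; toℕ; splitAt; _≟_)
open import Data.Fin.Subset using (Subset; _∈_; _∉_)
open import Data.Fin.Permutation using (Permutation′; _⟨$⟩ʳ_)
open import Data.Sum using (_⊎_; inj₁; inj₂)
open import Data.Product using (Σ; ∃; ∃-syntax; _×_; _,_)
open import Data.Unit using (⊤)
open import Relation.Nullary using (¬_; does)
open import Relation.Binary.PropositionalEquality using (_≡_; _≢_)

record Graph (n : ℕ) : Set where
  field
    Adj    : Fin n → Fin n → Bool
    sym    : ∀ u v → Adj u v ≡ Adj v u
    irrefl : ∀ u → Adj u u ≡ false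
open Graph public

Edge : ∀ {n} → Graph n → Fin n → Fin n → Set
Edge G u v = Adj G u v ≡ true

data WalkIn {n} (G : Graph n) (A : Fin n → Set) : Fin n → Fin n → ℕ → Set where
  nil  : ∀ {u} → A u → WalkIn G A u u 0
  cons : ∀ {u w v k} → A u → Edge G u w → WalkIn G A w v k → WalkIn G A u v (suc k)

Walk : ∀ {n} → Graph n → Fin n → Fin n → ℕ → Set
Walk G = WalkIn G (λ _ → ⊤)

Connected : ∀ {n} → Graph n → Set
Connected G = ∀ u v → ∃[ k ] Walk G u v k

Dist : ∀ {n} → Graph n → Fin n → Fin n → ℕ → Set
Dist G u v m = Walk G u v m × (∀ k → k < m → ¬ Walk G u v k)

InSphere : ∀ {n} → Graph n → Fin n → ℕ → Fin n → Set
InSphere G v m w = Dist G v w m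

ConnectedAvoiding : ∀ {n} → Graph n → Subset n → Fin n → Fin n → Set
ConnectedAvoiding G S u w = ∃[ k ] WalkIn G (λ x → x ∉ S) u w k

VertexSeparator : ∀ {n} → Graph n → Subset n → Set
VertexSeparator G S =
  ∃[ u ] ∃[ w ] (u ∉ S × w ∉ S × ¬ ConnectedAvoiding G S u w)

CommonSeparatingSubset : ∀ {n} → Graph n → Fin n → Fin n → ℕ → Subset n → Set
CommonSeparatingSubset G v v' m S =
  (∀ w → w ∈ S → InSphere G v m w × InSphere G v' m w)
  × VertexSeparator G S
  × (∃[ w ] (w ∉ S × ¬ ConnectedAvoiding G S w v × ¬ ConnectedAvoiding G S w v'))

InP : ∀ {n} → Graph n → Fin n → Fin n → Set
InP G v v' = v ≢ v' × ∃[ m ] (1 ≤ m × ∃[ S ] CommonSeparatingSubset G v v' m S)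

PNonempty : ∀ {n} → Graph n → Set
PNonempty G = ∃[ v ] ∃[ v' ] InP G v v'

completeAdj : ∀ {n} → Fin n → Fin n → Bool
completeAdj i j = not (does (i ≟ j))

pathAdj : ∀ {n} → Fin n → Fin n → Bool
pathAdj i j = (suc (toℕ i) ≡ᵇ toℕ j) ∨ (suc (toℕ j) ≡ᵇ toℕ i)

-- Gluing a complete graph K_{suc (suc j)} onto vertex a of a graph with
-- adjacency A on Fin n: the suc j new vertices are pairwise adjacent and
-- adjacent to a.
glueAdj : ∀ {n} (j : ℕ) → (Fin n → Fin n → Bool) → Fin n → Fin (n + suc j) → Fin (n + suc j) → Bool
glueAdj {n} j A a x y with splitAt n x | splitAt n y
... | inj₁ u | inj₁ v = A u v
... | inj₁ u | inj₂ _ = does (u ≟ a)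
... | inj₂ _ | inj₁ v = does (v ≟ a)
... | inj₂ p | inj₂ q = not (does (p ≟ q))

-- Adjacency relations produced by the block-graph construction:
-- start with K_{n₁} (n₁ ≥ 2), repeatedly glue K_{nᵢ} (nᵢ ≥ 2) at one vertex.
data Built : (n : ℕ) → (Fin n → Fin n → Bool) → Set where
  base : ∀ j → Built (suc (suc j)) completeAdj
  glue : ∀ {n A} j → Built n A → (a : Fin n) → Built (n + suc j) (glueAdj j A a)

IsoToAdj : ∀ {n} → Graph n → (Fin n → Fin n → Bool) → Set
IsoToAdj {n} G B = Σ (Permutation′ n) λ σ → ∀ u v → Adj G u v ≡ B (σ ⟨$⟩ʳ u) (σ ⟨$⟩ʳ v)

IsBlockGraph : ∀ {n} → Graph n → Set
IsBlockGraph {n} G = Σ (Fin n → Fin n → Bool) λ B → Built n B × IsoToAdj G B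

IsComplete : ∀ {n} → Graph n → Set
IsComplete G = ∀ u v → u ≢ v → Edge G u v

IsPath : ∀ {n} → Graph n → Set
IsPath G = IsoToAdj G pathAdj

NonElementary : ∀ {n} → Graph n → Set
NonElementary G = ¬ IsComplete G × ¬ IsPath G

-- Every block graph is complete, a path, or has a cut vertex c with two distinct
-- neighbours v, v′ and a third vertex w that G ∖ {c} separates from both. This
-- trichotomy follows the construction: gluing a block with at least three vertices,
-- or gluing an edge at an inner vertex of a path or at any vertex of a K_{≥3},
-- creates such a cut vertex, and later gluings preserve it. Taking m = 1 and S = {c}
-- then puts (v , v′) in 𝒫(G).
-- Conversely nothing separates a complete graph, and in a path every vertex at equal
-- distance from v ≠ v′ is their midpoint; so S has at most one vertex, and w stays
-- joined to whichever of v, v′ lies on its side of the midpoint.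
module Submission where

open import Defs
open import Data.Nat using (ℕ; zero; suc; _+_; _<_; _≤_; z≤n; s≤s; z<s; _≡ᵇ_)
import Data.Nat as ℕ
open import Data.Nat.Properties
  using (≤-refl; ≤-trans; ≤-total; ≤-antisym; <-irrefl; <-cmp; ≤-<-trans; <-≤-trans; ≮⇒≥; ≤∧≢⇒<; <⇒≢;
         n≤1+n; m≤m+n; m<m+n; +-suc; +-comm; +-identityʳ; +-cancelˡ-≤; +-cancelˡ-≡; +-cancelʳ-≡;
         +-mono-≤; +-mono-<; +-monoʳ-<; +-monoˡ-<; m≤n⇒∃[o]m+o≡n; m∸n+n≡m; suc-injective; 1+n≢n; ≡ᵇ⇒≡)
open import Data.Nat.Solver using (module +-*-Solver)
open import Data.Bool using (Bool; true; false; T; not; _∨_)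
open import Data.Bool.Properties using (∨-comm)
open import Data.Fin using (Fin; zero; suc; toℕ; fromℕ<; _≟_; _↑ˡ_; _↑ʳ_; splitAt; opposite)
open import Data.Fin.Properties
  using (toℕ-injective; toℕ-fromℕ<; toℕ<n; toℕ-↑ˡ; toℕ-↑ʳ; ↑ˡ-injective; ↑ʳ-injective; 0≢1+n;
         splitAt-↑ˡ; splitAt-↑ʳ; opposite-prop; +↔⊎)
open import Data.Fin.Subset using (_∈_; _∉_; ⁅_⁆)
open import Data.Fin.Subset.Properties using (x∈⁅x⁆; x∈⁅y⁆⇒x≡y)
open import Data.Fin.Permutation using (Permutation′; _⟨$⟩ʳ_; _⟨$⟩ˡ_; inverseˡ; inverseʳ; _∘ₚ_; reverse; id)
open import Data.Sum using (_⊎_; inj₁; inj₂; [_,_]; map₂)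
open import Data.Sum.Function.Propositional using (_⊎-↔_)
open import Data.Product using (Σ; ∃-syntax; _×_; _,_; proj₁; proj₂)
open import Data.Unit using (⊤; tt)
open import Data.Empty using (⊥; ⊥-elim)
open import Function.Base using (_∘_)
open import Function.Bundles using (_⇔_; mk⇔; Injection)
open import Function.Properties.Inverse using (↔-refl; ↔-sym; ↔-trans; ↔⇒↣)
open import Relation.Nullary using (¬_; yes; no; does)
open import Relation.Nullary.Decidable using (dec-true; dec-false)
open import Relation.Binary using (Tri; tri<; tri≈; tri>)
open import Relation.Binary.PropositionalEquality
  using (_≡_; _≢_; refl; trans; cong; cong₂; subst; subst₂) renaming (sym to ≡-sym)

⟨$⟩ʳ-injective : ∀ {n} (σ : Permutation′ n) {x y : Fin n} → σ ⟨$⟩ʳ x ≡ σ ⟨$⟩ʳ y → x ≡ y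
⟨$⟩ʳ-injective σ = Injection.injective (↔⇒↣ σ)

⟨$⟩ˡ-injective : ∀ {n} (σ : Permutation′ n) {x y : Fin n} → σ ⟨$⟩ˡ x ≡ σ ⟨$⟩ˡ y → x ≡ y
⟨$⟩ˡ-injective σ = Injection.injective (↔⇒↣ (↔-sym σ))

module _ {n} (G : Graph n) where

  Edge-sym : ∀ {u v} → Edge G u v → Edge G v u
  Edge-sym {u} {v} e = trans (sym G v u) e

  Edge⇒≢ : ∀ {u v} → Edge G u v → u ≢ v
  Edge⇒≢ {u} e refl with trans (≡-sym e) (irrefl G u)
  ... | ()

  WalkIn-map : ∀ {P Q : Fin n → Set} → (∀ {u} → P u → Q u) →
               ∀ {x y k} → WalkIn G P x y k → WalkIn G Q x y k
  WalkIn-map h (nil p)      = nil (h p)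
  WalkIn-map h (cons p e w) = cons (h p) e (WalkIn-map h w)

  WalkIn-snoc : ∀ {P : Fin n → Set} {x y z k} →
                WalkIn G P x y k → Edge G y z → P z → WalkIn G P x z (suc k)
  WalkIn-snoc (nil p)      e q = cons p e (nil q)
  WalkIn-snoc (cons p e w) f q = cons p e (WalkIn-snoc w f q)

  WalkIn-reverse : ∀ {P : Fin n → Set} {x y k} → WalkIn G P x y k → WalkIn G P y x k
  WalkIn-reverse (nil p)      = nil p
  WalkIn-reverse (cons p e w) = WalkIn-snoc (WalkIn-reverse w) (Edge-sym e) p

-- Paths

-- pathAdj i j reduces to pathAdjℕ (toℕ i) (toℕ j).
pathAdjℕ : ℕ → ℕ → Bool
pathAdjℕ x y = (suc x ≡ᵇ y) ∨ (suc y ≡ᵇ x)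

≡ᵇ-refl : ∀ m → (m ≡ᵇ m) ≡ true
≡ᵇ-refl zero    = refl
≡ᵇ-refl (suc m) = ≡ᵇ-refl m

Adjacentℕ : ℕ → ℕ → Set
Adjacentℕ x y = suc x ≡ y ⊎ suc y ≡ x

pathAdjℕ-true⇒adjacent : ∀ x y → pathAdjℕ x y ≡ true → Adjacentℕ x y
pathAdjℕ-true⇒adjacent x y e with suc x ≡ᵇ y in e₁ | suc y ≡ᵇ x in e₂
... | true  | _    = inj₁ (≡ᵇ⇒≡ _ _ (subst T (≡-sym e₁) tt))
... | false | true = inj₂ (≡ᵇ⇒≡ _ _ (subst T (≡-sym e₂) tt))

adjacent⇒pathAdjℕ-true : ∀ x y → Adjacentℕ x y → pathAdjℕ x y ≡ true
adjacent⇒pathAdjℕ-true x .(suc x) (inj₁ refl) rewrite ≡ᵇ-refl x = refl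
adjacent⇒pathAdjℕ-true .(suc y) y (inj₂ refl) with suc (suc y) ≡ᵇ y
... | true  = refl
... | false rewrite ≡ᵇ-refl y = refl

pathAdjℕ-≡ : ∀ {b x y} → (b ≡ true → Adjacentℕ x y) → (Adjacentℕ x y → b ≡ true) → b ≡ pathAdjℕ x y
pathAdjℕ-≡ {true}  {x} {y} b⇒adj _ = ≡-sym (adjacent⇒pathAdjℕ-true x y (b⇒adj refl))
pathAdjℕ-≡ {false} {x} {y} _ adj⇒b with pathAdjℕ x y in e
... | false = refl
... | true  = adj⇒b (pathAdjℕ-true⇒adjacent x y e)

pathAdjℕ-irrefl : ∀ x → pathAdjℕ x x ≡ false
pathAdjℕ-irrefl x = ≡-sym (pathAdjℕ-≡ {false} {x} {x} (λ ()) (⊥-elim ∘ not-adjacent))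
  where
  not-adjacent : ¬ Adjacentℕ x x
  not-adjacent (inj₁ e) = 1+n≢n e
  not-adjacent (inj₂ e) = 1+n≢n e

pathAdjℕ-sym : ∀ x y → pathAdjℕ x y ≡ pathAdjℕ y x
pathAdjℕ-sym x y = ∨-comm (suc x ≡ᵇ y) (suc y ≡ᵇ x)

complement-sym : ∀ {N x i} → x + suc i ≡ N → i + suc x ≡ N
complement-sym {x = x} {i} e = trans (+-suc i x) (trans (cong suc (+-comm i x)) (trans (≡-sym (+-suc x i)) e))

complement-adjacent : ∀ {N x y i j} → x + suc i ≡ N → y + suc j ≡ N → Adjacentℕ x y → Adjacentℕ i j
complement-adjacent {x = x} {j = j} ex ey (inj₁ refl) =
  inj₂ (suc-injective (+-cancelˡ-≡ x _ _ (trans (+-suc x (suc j)) (trans ey (≡-sym ex)))))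
complement-adjacent {y = y} {i} ex ey (inj₂ refl) =
  inj₁ (suc-injective (+-cancelˡ-≡ y _ _ (trans (+-suc y (suc i)) (trans ex (≡-sym ey)))))

step-bounds : ∀ {a b c k} → Adjacentℕ a b →
              c ≤ b + k × b ≤ c + k → c ≤ a + suc k × a ≤ c + suc k
step-bounds {a} {c = c} {k} (inj₁ refl) (c≤b+k , b≤c+k) =
  subst (c ≤_) (≡-sym (+-suc a k)) c≤b+k , ≤-trans (n≤1+n a) (≤-trans b≤c+k (+-mono-≤ (≤-refl {c}) (n≤1+n k)))
step-bounds {b = b} {c} {k} (inj₂ refl) (c≤b+k , b≤c+k) =
  ≤-trans c≤b+k (+-mono-≤ (n≤1+n b) (n≤1+n k)) , subst (suc b ≤_) (≡-sym (+-suc c k)) (s≤s b≤c+k)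

equidistant⇒midpoint : ∀ {a b p m} → a ≢ b →
                       p ≡ a + m ⊎ a ≡ p + m → p ≡ b + m ⊎ b ≡ p + m → a + b ≡ p + p
equidistant⇒midpoint {a} {b} {m = m} a≢b (inj₁ refl) (inj₁ e) = ⊥-elim (a≢b (+-cancelʳ-≡ m a b e))
equidistant⇒midpoint {a} {m = m} _ (inj₁ refl) (inj₂ refl) =
  solve 2 (λ a m → a :+ ((a :+ m) :+ m) := (a :+ m) :+ (a :+ m)) refl a m
  where open +-*-Solver
equidistant⇒midpoint {b = b} {m = m} _ (inj₂ refl) (inj₁ refl) =
  solve 2 (λ b m → ((b :+ m) :+ m) :+ b := (b :+ m) :+ (b :+ m)) refl b m
  where open +-*-Solver
equidistant⇒midpoint a≢b (inj₂ refl) (inj₂ e) = ⊥-elim (a≢b (≡-sym e))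

x+x≡y+y⇒x≡y : ∀ {x y} → x + x ≡ y + y → x ≡ y
x+x≡y+y⇒x≡y {x} {y} e with <-cmp x y
... | tri< x<y _ _ = ⊥-elim (<-irrefl e (+-mono-< x<y x<y))
... | tri≈ _ x≡y _ = x≡y
... | tri> _ _ y<x = ⊥-elim (<-irrefl (≡-sym e) (+-mono-< y<x y<x))

lower-endpoint : ∀ {a b} → a ≢ b → a + a < a + b ⊎ b + b < a + b
lower-endpoint {a} {b} a≢b with <-cmp a b
... | tri< a<b _ _ = inj₁ (+-monoʳ-< a a<b)
... | tri≈ _ a≡b _ = ⊥-elim (a≢b a≡b)
... | tri> _ _ b<a = inj₂ (+-monoˡ-< b b<a)

upper-endpoint : ∀ {a b} → a ≢ b → a + b < a + a ⊎ a + b < b + b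
upper-endpoint {a} {b} a≢b with <-cmp a b
... | tri< a<b _ _ = inj₂ (+-monoˡ-< b a<b)
... | tri≈ _ a≡b _ = ⊥-elim (a≢b a≡b)
... | tri> _ _ b<a = inj₁ (+-monoʳ-< a b<a)

Convex : (ℕ → Set) → Set
Convex P = ∀ {i j k} → i ≤ j → j ≤ k → P i → P k → P j

below-convex : ∀ t → Convex (λ i → i + i < t)
below-convex t _ j≤k _ k<t = ≤-<-trans (+-mono-≤ j≤k j≤k) k<t

above-convex : ∀ t → Convex (λ i → t < i + i)
above-convex t i≤j _ t<i _ = <-≤-trans t<i (+-mono-≤ i≤j i≤j)

module Positions {n} (σ : Permutation′ n) where

  pos : Fin n → ℕ
  pos u = toℕ (σ ⟨$⟩ʳ u)

  pos-injective : ∀ {x y} → pos x ≡ pos y → x ≡ y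
  pos-injective e = ⟨$⟩ʳ-injective σ (toℕ-injective e)

  pos<n : ∀ u → pos u < n
  pos<n u = toℕ<n (σ ⟨$⟩ʳ u)

  vertex-at : ∀ {k} → k < n → ∃[ u ] pos u ≡ k
  vertex-at k<n = σ ⟨$⟩ˡ fromℕ< k<n , trans (cong toℕ (inverseʳ σ)) (toℕ-fromℕ< k<n)

  next-vertex : ∀ {x y} → pos x < pos y → ∃[ w ] pos w ≡ suc (pos x)
  next-vertex {y = y} x<y = vertex-at (≤-<-trans x<y (pos<n y))

module PathGraph {n} (G : Graph n) (σ : Permutation′ n)
                 (iso : ∀ u v → Adj G u v ≡ pathAdj (σ ⟨$⟩ʳ u) (σ ⟨$⟩ʳ v)) where

  open Positions σ

  Edge⇒adjacent : ∀ {x y} → Edge G x y → Adjacentℕ (pos x) (pos y)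
  Edge⇒adjacent {x} {y} e = pathAdjℕ-true⇒adjacent (pos x) (pos y) (trans (≡-sym (iso x y)) e)

  walk-length-bounds : ∀ {P x y k} → WalkIn G P x y k → pos y ≤ pos x + k × pos x ≤ pos y + k
  walk-length-bounds {x = x} (nil _) = le , le
    where
    le : pos x ≤ pos x + 0
    le = subst (pos x ≤_) (≡-sym (+-identityʳ (pos x))) ≤-refl
  walk-length-bounds (cons _ e rest) = step-bounds (Edge⇒adjacent e) (walk-length-bounds rest)

  ascending-walk : ∀ d x y → pos y ≡ pos x + d → WalkIn G (λ u → pos x ≤ pos u × pos u ≤ pos y) x y d
  ascending-walk zero x y e with pos-injective {x} {y} (≡-sym (trans e (+-identityʳ _)))
  ... | refl = nil (≤-refl , ≤-refl)
  ascending-walk (suc d) x y e with next-vertex (subst (pos x <_) (≡-sym e) (m<m+n (pos x) z<s))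
  ... | w , pos-w =
        cons (≤-refl , x≤y) x~w (WalkIn-map G (λ (w≤u , u≤y) → ≤-trans (n≤1+n _) (subst (_≤ _) pos-w w≤u) , u≤y) w⇝y)
    where
    x≤y : pos x ≤ pos y
    x≤y = subst (pos x ≤_) (≡-sym e) (m≤m+n (pos x) (suc d))
    x~w : Edge G x w
    x~w = trans (iso x w) (adjacent⇒pathAdjℕ-true (pos x) (pos w) (inj₁ (≡-sym pos-w)))
    w⇝y : WalkIn G (λ u → pos w ≤ pos u × pos u ≤ pos y) w y d
    w⇝y = ascending-walk d w y (trans e (trans (+-suc (pos x) d) (cong (_+ d) (≡-sym pos-w))))

  walk-within-convex : ∀ {P} → Convex P → ∀ {x y} → P (pos x) → P (pos y) →
                       ∃[ k ] WalkIn G (λ u → P (pos u)) x y k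
  walk-within-convex convex {x} {y} px py with ≤-total (pos x) (pos y)
  ... | inj₁ x≤y with m≤n⇒∃[o]m+o≡n x≤y
  ...   | d , e = d , WalkIn-map G (λ (x≤u , u≤y) → convex x≤u u≤y px py) (ascending-walk d x y (≡-sym e))
  walk-within-convex convex {x} {y} px py | inj₂ y≤x with m≤n⇒∃[o]m+o≡n y≤x
  ...   | d , e =
        d , WalkIn-reverse G (WalkIn-map G (λ (y≤u , u≤x) → convex y≤u u≤x py px) (ascending-walk d y x (≡-sym e)))

  Dist-sym : ∀ {v s m} → Dist G v s m → Dist G s v m
  Dist-sym (walk , minimal) = WalkIn-reverse G walk , λ k k<m walk′ → minimal k k<m (WalkIn-reverse G walk′)

  Dist-ascending : ∀ {v s m} → Dist G v s m → pos v ≤ pos s → pos s ≡ pos v + m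
  Dist-ascending {v} {s} {m} (walk , minimal) v≤s with m≤n⇒∃[o]m+o≡n v≤s
  ... | d , e = trans (≡-sym e) (cong (pos v +_) (≤-antisym d≤m m≤d))
    where
    m≤d : m ≤ d
    m≤d = ≮⇒≥ (λ d<m → minimal d d<m (WalkIn-map G (λ _ → tt) (ascending-walk d v s (≡-sym e))))
    d≤m : d ≤ m
    d≤m = +-cancelˡ-≤ (pos v) _ _ (subst (_≤ pos v + m) (≡-sym e) (proj₁ (walk-length-bounds walk)))

  Dist⇒pos : ∀ {v s m} → Dist G v s m → pos s ≡ pos v + m ⊎ pos v ≡ pos s + m
  Dist⇒pos {v} {s} dist with ≤-total (pos v) (pos s)
  ... | inj₁ v≤s = inj₁ (Dist-ascending dist v≤s)
  ... | inj₂ s≤v = inj₂ (Dist-ascending (Dist-sym dist) s≤v)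

  sphere-midpoint : ∀ {v v′ m s} → v ≢ v′ → InSphere G v m s → InSphere G v′ m s →
                    pos v + pos v′ ≡ pos s + pos s
  sphere-midpoint v≢v′ s∈Sv s∈Sv′ =
    equidistant⇒midpoint (λ e → v≢v′ (pos-injective e)) (Dist⇒pos s∈Sv) (Dist⇒pos s∈Sv′)

  P-empty : ¬ PNonempty G
  P-empty (v , v′ , v≢v′ , _ , _ , S , S⊆spheres , _ , z , z∉S , z↛v , z↛v′) =
    locate-z (<-cmp (pos z + pos z) (pos v + pos v′))
    where
    pos-v≢pos-v′ : pos v ≢ pos v′
    pos-v≢pos-v′ e = v≢v′ (pos-injective e)

    S⊆midpoint : ∀ {u} → u ∈ S → pos v + pos v′ ≡ pos u + pos u
    S⊆midpoint u∈S = sphere-midpoint v≢v′ (proj₁ (S⊆spheres _ u∈S)) (proj₂ (S⊆spheres _ u∈S))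

    avoiding : ∀ {P} → Convex P → (∀ {u} → P (pos u) → u ∉ S) → ∀ {t} → P (pos z) → P (pos t) →
               ConnectedAvoiding G S z t
    avoiding convex P⇒∉S pz pt with walk-within-convex convex pz pt
    ... | k , walk = k , WalkIn-map G P⇒∉S walk

    below⇒∉S : ∀ {u} → pos u + pos u < pos v + pos v′ → u ∉ S
    below⇒∉S u-below u∈S = <-irrefl (≡-sym (S⊆midpoint u∈S)) u-below

    above⇒∉S : ∀ {u} → pos v + pos v′ < pos u + pos u → u ∉ S
    above⇒∉S u-above u∈S = <-irrefl (S⊆midpoint u∈S) u-above

    locate-z : Tri (pos z + pos z < pos v + pos v′) _ _ → ⊥
    locate-z (tri< z-below _ _) with lower-endpoint pos-v≢pos-v′
    ... | inj₁ v-below  = z↛v  (avoiding (below-convex _) below⇒∉S z-below v-below)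
    ... | inj₂ v′-below = z↛v′ (avoiding (below-convex _) below⇒∉S z-below v′-below)
    locate-z (tri> _ _ z-above) with upper-endpoint pos-v≢pos-v′
    ... | inj₁ v-above  = z↛v  (avoiding (above-convex _) above⇒∉S z-above v-above)
    ... | inj₂ v′-above = z↛v′ (avoiding (above-convex _) above⇒∉S z-above v′-above)
    locate-z (tri≈ _ z-mid _) = z↛v (avoiding {λ _ → ⊤} (λ _ _ _ _ → tt) (λ _ → S-empty) tt tt)
      where
      S-empty : ∀ {u} → u ∉ S
      S-empty {u} u∈S = z∉S (subst (_∈ S) u≡z u∈S)
        where
        u≡z : u ≡ z
        u≡z = pos-injective (x+x≡y+y⇒x≡y (trans (≡-sym (S⊆midpoint u∈S)) (≡-sym z-mid)))

-- Gluing blocks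

-- Walks for bare adjacency functions, as produced by Built, which are not packaged as graphs.
data Reach {n} (B : Fin n → Fin n → Bool) (P : Fin n → Set) : Fin n → Fin n → Set where
  here  : ∀ {u} → P u → Reach B P u u
  there : ∀ {u w v} → P u → B u w ≡ true → Reach B P w v → Reach B P u v

Reach-start : ∀ {n B P} {x y : Fin n} → Reach B P x y → P x
Reach-start (here p)      = p
Reach-start (there p _ _) = p

Reach-end : ∀ {n B P} {x y : Fin n} → Reach B P x y → P y
Reach-end (here p)      = p
Reach-end (there _ _ r) = Reach-end r

Reach-map : ∀ {n m} {B : Fin n → Fin n → Bool} {C : Fin m → Fin m → Bool} {P : Fin n → Set} {Q : Fin m → Set}
            (f : Fin n → Fin m) → (∀ {x y} → B x y ≡ true → f x ≡ f y ⊎ C (f x) (f y) ≡ true) →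
            (∀ {x} → P x → Q (f x)) → ∀ {x y} → Reach B P x y → Reach C Q (f x) (f y)
Reach-map f f-edge f-P (here p) = here (f-P p)
Reach-map {C = C} {Q = Q} f f-edge f-P {y = y} (there p e r) with f-edge e
... | inj₁ eq = subst (λ z → Reach C Q z (f y)) (≡-sym eq) (Reach-map f f-edge f-P r)
... | inj₂ e′ = there (f-P p) e′ (Reach-map f f-edge f-P r)

WalkIn⇒Reach : ∀ {n} {G : Graph n} {P x y k} → WalkIn G P x y k → Reach (Adj G) P x y
WalkIn⇒Reach (nil p)      = here p
WalkIn⇒Reach (cons p e w) = there p e (WalkIn⇒Reach w)

does-true⇒ : ∀ {n} {x y : Fin n} → does (x ≟ y) ≡ true → x ≡ y
does-true⇒ {x = x} {y} e with x ≟ y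
... | yes x≡y = x≡y

data OldOrNew (n m : ℕ) : Fin (n + m) → Set where
  old : (u : Fin n) → OldOrNew n m (u ↑ˡ m)
  new : (p : Fin m) → OldOrNew n m (n ↑ʳ p)

oldOrNew : ∀ n {m} (x : Fin (n + m)) → OldOrNew n m x
oldOrNew zero    x       = new x
oldOrNew (suc n) zero    = old zero
oldOrNew (suc n) (suc x) with oldOrNew n x
... | old u = old (suc u)
... | new p = new p

old≢new : ∀ {n m} (u : Fin n) (p : Fin m) → u ↑ˡ m ≢ n ↑ʳ p
old≢new {n} {m} u p e with trans (≡-sym (splitAt-↑ˡ n u m)) (trans (cong (splitAt n) e) (splitAt-↑ʳ n m p))
... | ()

record CutWitness {n} (B : Fin n → Fin n → Bool) : Set where
  field
    cut v v′ w : Fin n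
    v≢v′   : v ≢ v′
    cut~v  : B cut v ≡ true
    cut~v′ : B cut v′ ≡ true
    w≢cut  : w ≢ cut
    w↛v    : ¬ Reach B (_≢ cut) w v
    w↛v′   : ¬ Reach B (_≢ cut) w v′

TwoNeighbours : ∀ {n} → (Fin n → Fin n → Bool) → Fin n → Set
TwoNeighbours B a = ∃[ p ] ∃[ q ] p ≢ q × B a p ≡ true × B a q ≡ true

module Glue {n} (j : ℕ) (A : Fin n → Fin n → Bool) (a : Fin n) where

  B : Fin (n + suc j) → Fin (n + suc j) → Bool
  B = glueAdj j A a

  glue-old-old : ∀ u v → B (u ↑ˡ suc j) (v ↑ˡ suc j) ≡ A u v
  glue-old-old u v rewrite splitAt-↑ˡ n u (suc j) | splitAt-↑ˡ n v (suc j) = refl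

  glue-old-new : ∀ u p → B (u ↑ˡ suc j) (n ↑ʳ p) ≡ does (u ≟ a)
  glue-old-new u p rewrite splitAt-↑ˡ n u (suc j) | splitAt-↑ʳ n (suc j) p = refl

  glue-new-old : ∀ p v → B (n ↑ʳ p) (v ↑ˡ suc j) ≡ does (v ≟ a)
  glue-new-old p v rewrite splitAt-↑ʳ n (suc j) p | splitAt-↑ˡ n v (suc j) = refl

  glue-new-new : ∀ p q → B (n ↑ʳ p) (n ↑ʳ q) ≡ not (does (p ≟ q))
  glue-new-new p q rewrite splitAt-↑ʳ n (suc j) p | splitAt-↑ʳ n (suc j) q = refl

  IsOld IsNew : Fin (n + suc j) → Set
  IsOld x = ∃[ u ] x ≡ u ↑ˡ suc j
  IsNew x = ∃[ p ] x ≡ n ↑ʳ p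

  Reach-from-new : ∀ {x y} → Reach B (_≢ a ↑ˡ suc j) x y → IsNew x → IsNew y
  Reach-from-new (here _) x-new = x-new
  Reach-from-new (there {w = w} _ e r) (p , refl) with oldOrNew n w
  ... | old u = ⊥-elim (Reach-start r (cong (_↑ˡ suc j) (does-true⇒ (trans (≡-sym (glue-new-old p u)) e))))
  ... | new q = Reach-from-new r (q , refl)

  Reach-from-old : ∀ {x y} → Reach B (_≢ a ↑ˡ suc j) x y → IsOld x →
                   Reach B (λ z → z ≢ a ↑ˡ suc j × IsOld z) x y
  Reach-from-old (here x≢a) x-old = here (x≢a , x-old)
  Reach-from-old (there {w = w} x≢a e r) (u , refl) with oldOrNew n w
  ... | old u′ = there (x≢a , u , refl) e (Reach-from-old r (u′ , refl))
  ... | new q  = ⊥-elim (x≢a (cong (_↑ˡ suc j) (does-true⇒ (trans (≡-sym (glue-old-new u q)) e))))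

  collapse : Fin (n + suc j) → Fin n
  collapse x = [ (λ u → u) , (λ _ → a) ] (splitAt n x)

  collapse-old : ∀ u → collapse (u ↑ˡ suc j) ≡ u
  collapse-old u rewrite splitAt-↑ˡ n u (suc j) = refl

  collapse-new : ∀ p → collapse (n ↑ʳ p) ≡ a
  collapse-new p rewrite splitAt-↑ʳ n (suc j) p = refl

  collapse-edge : ∀ {x y} → B x y ≡ true → collapse x ≡ collapse y ⊎ A (collapse x) (collapse y) ≡ true
  collapse-edge {x} {y} e with oldOrNew n x | oldOrNew n y
  ... | old u | old v rewrite collapse-old u | collapse-old v = inj₂ (trans (≡-sym (glue-old-old u v)) e)
  ... | old u | new p rewrite collapse-old u | collapse-new p = inj₁ (does-true⇒ (trans (≡-sym (glue-old-new u p)) e))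
  ... | new p | old v rewrite collapse-new p | collapse-old v = inj₁ (≡-sym (does-true⇒ (trans (≡-sym (glue-new-old p v)) e)))
  ... | new p | new q rewrite collapse-new p | collapse-new q = inj₁ refl

  Reach-old⇒Reach : ∀ c x y → Reach B (_≢ c ↑ˡ suc j) (x ↑ˡ suc j) (y ↑ˡ suc j) → Reach A (_≢ c) x y
  -- New vertices collapse onto a; when the avoided vertex is a itself, the walk cannot enter the new block.
  Reach-old⇒Reach c x y r with c ≟ a
  ... | no c≢a = subst₂ (Reach A (_≢ c)) (collapse-old x) (collapse-old y)
                        (Reach-map collapse collapse-edge (λ {z} → avoids z) r)
    where
    avoids : ∀ z → z ≢ c ↑ˡ suc j → collapse z ≢ c
    avoids z z≢c with oldOrNew n z
    ... | old u rewrite collapse-old u = λ u≡c → z≢c (cong (_↑ˡ suc j) u≡c)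
    ... | new p rewrite collapse-new p = λ a≡c → c≢a (≡-sym a≡c)
  ... | yes refl = subst₂ (Reach A (_≢ c)) (collapse-old x) (collapse-old y)
                          (Reach-map collapse collapse-edge (λ {z} → avoids z) (Reach-from-old r (x , refl)))
    where
    avoids : ∀ z → z ≢ c ↑ˡ suc j × IsOld z → collapse z ≢ c
    avoids .(u ↑ˡ suc j) (z≢c , u , refl) rewrite collapse-old u = λ u≡c → z≢c (cong (_↑ˡ suc j) u≡c)

  CutWitness-lift : CutWitness A → CutWitness B
  CutWitness-lift record { cut = c ; v = v ; v′ = v′ ; w = w ; v≢v′ = v≢v′ ; cut~v = c~v ; cut~v′ = c~v′
                         ; w≢cut = w≢c ; w↛v = w↛v ; w↛v′ = w↛v′ } = record
    { cut = c ↑ˡ suc j ; v = v ↑ˡ suc j ; v′ = v′ ↑ˡ suc j ; w = w ↑ˡ suc j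
    ; v≢v′   = λ e → v≢v′ (↑ˡ-injective (suc j) v v′ e)
    ; cut~v  = trans (glue-old-old c v) c~v
    ; cut~v′ = trans (glue-old-old c v′) c~v′
    ; w≢cut  = λ e → w≢c (↑ˡ-injective (suc j) w c e)
    ; w↛v    = λ r → w↛v (Reach-old⇒Reach c w v r)
    ; w↛v′   = λ r → w↛v′ (Reach-old⇒Reach c w v′ r)
    }

  CutWitness-at-two-neighbours : TwoNeighbours A a → CutWitness B
  CutWitness-at-two-neighbours (p , q , p≢q , a~p , a~q) = record
    { cut = a ↑ˡ suc j ; v = p ↑ˡ suc j ; v′ = q ↑ˡ suc j ; w = n ↑ʳ zero
    ; v≢v′   = λ e → p≢q (↑ˡ-injective (suc j) p q e)
    ; cut~v  = trans (glue-old-old a p) a~p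
    ; cut~v′ = trans (glue-old-old a q) a~q
    ; w≢cut  = λ e → old≢new a zero (≡-sym e)
    ; w↛v    = λ r → let (r′ , e) = Reach-from-new r (zero , refl) in old≢new p r′ e
    ; w↛v′   = λ r → let (r′ , e) = Reach-from-new r (zero , refl) in old≢new q r′ e
    }

CutWitness-large-block : ∀ {n} j (A : Fin n → Fin n → Bool) (a b : Fin n) → b ≢ a →
                         CutWitness (glueAdj (suc j) A a)
CutWitness-large-block {n} j A a b b≢a = record
  { cut = a ↑ˡ suc (suc j) ; v = n ↑ʳ zero ; v′ = n ↑ʳ suc zero ; w = b ↑ˡ suc (suc j)
  ; v≢v′   = λ e → 0≢1+n (↑ʳ-injective n zero (suc zero) e)
  ; cut~v  = trans (glue-old-new a zero) (dec-true (a ≟ a) refl)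
  ; cut~v′ = trans (glue-old-new a (suc zero)) (dec-true (a ≟ a) refl)
  ; w≢cut  = λ e → b≢a (↑ˡ-injective (suc (suc j)) b a e)
  ; w↛v    = λ r → let (u , e) = proj₂ (Reach-end (Reach-from-old r (b , refl))) in old≢new u zero (≡-sym e)
  ; w↛v′   = λ r → let (u , e) = proj₂ (Reach-end (Reach-from-old r (b , refl))) in old≢new u (suc zero) (≡-sym e)
  }
  where
  open Glue (suc j) A a

PathShaped : ∀ {n} → (Fin n → Fin n → Bool) → Set
PathShaped {n} B = Σ (Permutation′ n) λ σ → ∀ x y → B x y ≡ pathAdj (σ ⟨$⟩ʳ x) (σ ⟨$⟩ʳ y)

opposite+suc≡n : ∀ {n} (i : Fin n) → toℕ (opposite i) + suc (toℕ i) ≡ n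
opposite+suc≡n i = trans (cong (_+ suc (toℕ i)) (opposite-prop i)) (m∸n+n≡m (toℕ<n i))

pathAdj-opposite : ∀ {n} (i j : Fin n) → pathAdj i j ≡ pathAdj (opposite i) (opposite j)
pathAdj-opposite i j = pathAdjℕ-≡
  (λ e → complement-adjacent (complement-sym (opposite+suc≡n i)) (complement-sym (opposite+suc≡n j))
                             (pathAdjℕ-true⇒adjacent _ _ e))
  (λ adj → adjacent⇒pathAdjℕ-true _ _ (complement-adjacent (opposite+suc≡n i) (opposite+suc≡n j) adj))

module ExtendPath {n} (A : Fin n → Fin n → Bool) (a : Fin n) (σ : Permutation′ n)
                  (iso : ∀ x y → A x y ≡ pathAdj (σ ⟨$⟩ʳ x) (σ ⟨$⟩ʳ y)) where

  open Positions σ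
  open Glue zero A a

  -- σ on the old vertices, and the new vertex goes to position n, just after a.
  τ : Permutation′ (n + 1)
  τ = ↔-trans +↔⊎ (↔-trans (σ ⊎-↔ ↔-refl) (↔-sym +↔⊎))

  τ-old : ∀ u → toℕ (τ ⟨$⟩ʳ (u ↑ˡ 1)) ≡ pos u
  τ-old u rewrite splitAt-↑ˡ n u 1 = toℕ-↑ˡ (σ ⟨$⟩ʳ u) 1

  τ-new : ∀ p → toℕ (τ ⟨$⟩ʳ (n ↑ʳ p)) ≡ n
  τ-new zero rewrite splitAt-↑ʳ n 1 zero = trans (toℕ-↑ʳ n zero) (+-identityʳ n)

  module _ (a-last : suc (pos a) ≡ n) where

    adjacent-to-n⇔a : ∀ u → does (u ≟ a) ≡ pathAdjℕ (pos u) n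
    adjacent-to-n⇔a u = pathAdjℕ-≡
      (λ e → subst (λ z → Adjacentℕ (pos z) n) (≡-sym (does-true⇒ e)) (inj₁ a-last))
      (λ adj → dec-true (u ≟ a) (adjacent⇒a adj))
      where
      adjacent⇒a : Adjacentℕ (pos u) n → u ≡ a
      adjacent⇒a (inj₁ e) = pos-injective (suc-injective (trans e (≡-sym a-last)))
      adjacent⇒a (inj₂ e) = ⊥-elim (<⇒≢ (≤-trans (pos<n u) (n≤1+n n)) (≡-sym e))

    extended : PathShaped (glueAdj zero A a)
    extended = τ , iso′
      where
      iso′ : ∀ x y → glueAdj zero A a x y ≡ pathAdj (τ ⟨$⟩ʳ x) (τ ⟨$⟩ʳ y)
      iso′ x y with oldOrNew n x | oldOrNew n y
      ... | old u | old v rewrite τ-old u | τ-old v = trans (glue-old-old u v) (iso u v)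
      ... | old u | new p rewrite τ-old u | τ-new p = trans (glue-old-new u p) (adjacent-to-n⇔a u)
      ... | new p | old v rewrite τ-new p | τ-old v =
            trans (glue-new-old p v) (trans (adjacent-to-n⇔a v) (pathAdjℕ-sym (pos v) n))
      ... | new zero | new zero rewrite τ-new zero = trans (glue-new-new zero zero) (≡-sym (pathAdjℕ-irrefl n))

module _ {n} {A : Fin n → Fin n → Bool} (σ : Permutation′ n)
         (iso : ∀ x y → A x y ≡ pathAdj (σ ⟨$⟩ʳ x) (σ ⟨$⟩ʳ y)) where

  open Positions σ

  inner-vertex-TwoNeighbours : ∀ a {k} → pos a ≡ suc k → suc (suc k) < n → TwoNeighbours A a
  inner-vertex-TwoNeighbours a {k} a-at-1+k 2+k<n =
    p , q , p≢q , trans (iso a p) (adjacent⇒pathAdjℕ-true (pos a) (pos p) (inj₂ (trans (cong suc pos-p) (≡-sym a-at-1+k))))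
                , trans (iso a q) (adjacent⇒pathAdjℕ-true (pos a) (pos q) (inj₁ (trans (cong suc a-at-1+k) (≡-sym pos-q))))
    where
    p q : Fin n
    p = proj₁ (vertex-at (≤-trans (n≤1+n _) (≤-trans (n≤1+n _) 2+k<n)))
    pos-p : pos p ≡ k
    pos-p = proj₂ (vertex-at (≤-trans (n≤1+n _) (≤-trans (n≤1+n _) 2+k<n)))
    q = proj₁ (vertex-at 2+k<n)
    pos-q : pos q ≡ suc (suc k)
    pos-q = proj₂ (vertex-at 2+k<n)
    p≢q : p ≢ q
    p≢q p≡q = <⇒≢ (n≤1+n (suc k)) (trans (≡-sym pos-p) (trans (cong pos p≡q) pos-q))

  PathShaped-glue-leaf : (a : Fin n) → CutWitness (glueAdj zero A a) ⊎ PathShaped (glueAdj zero A a)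
  PathShaped-glue-leaf a with pos a in a-at
  -- a is the first vertex: reversing the path makes it the last one.
  ... | zero = inj₂ (ExtendPath.extended A a σ′ iso′ a-last′)
    where
    σ′ : Permutation′ n
    σ′ = σ ∘ₚ reverse
    iso′ : ∀ x y → A x y ≡ pathAdj (σ′ ⟨$⟩ʳ x) (σ′ ⟨$⟩ʳ y)
    iso′ x y = trans (iso x y) (pathAdj-opposite (σ ⟨$⟩ʳ x) (σ ⟨$⟩ʳ y))
    a-last′ : suc (toℕ (σ′ ⟨$⟩ʳ a)) ≡ n
    a-last′ = subst (λ i → i + suc (toℕ (σ′ ⟨$⟩ʳ a)) ≡ n) a-at (complement-sym (opposite+suc≡n (σ ⟨$⟩ʳ a)))
  ... | suc k with suc (suc k) ℕ.≟ n
  ...   | yes 2+k≡n = inj₂ (ExtendPath.extended A a σ iso (trans (cong suc a-at) 2+k≡n))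
  ...   | no 2+k≢n  = inj₁ (Glue.CutWitness-at-two-neighbours zero A a
                             (inner-vertex-TwoNeighbours a a-at (≤∧≢⇒< (subst (λ i → suc i ≤ n) a-at (pos<n a)) 2+k≢n)))

LargeComplete : ∀ {n} → (Fin n → Fin n → Bool) → Set
LargeComplete {n} B = 3 ≤ n × (∀ x y → B x y ≡ completeAdj x y)

completeAdj-≢ : ∀ {n} {x y : Fin n} → x ≢ y → completeAdj x y ≡ true
completeAdj-≢ {x = x} {y} x≢y = cong not (dec-false (x ≟ y) x≢y)

two-others : ∀ {n} → 3 ≤ n → (a : Fin n) → ∃[ p ] ∃[ q ] p ≢ q × a ≢ p × a ≢ q
two-others (s≤s (s≤s (s≤s _))) zero          = suc zero , suc (suc zero) , (λ ()) , (λ ()) , (λ ())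
two-others (s≤s (s≤s (s≤s _))) (suc zero)    = zero , suc (suc zero) , (λ ()) , (λ ()) , (λ ())
two-others (s≤s (s≤s (s≤s _))) (suc (suc a)) = zero , suc zero , (λ ()) , (λ ()) , (λ ())

LargeComplete⇒TwoNeighbours : ∀ {n} {B : Fin n → Fin n → Bool} → LargeComplete B → ∀ a → TwoNeighbours B a
LargeComplete⇒TwoNeighbours {B = B} (3≤n , B≗complete) a with two-others 3≤n a
... | p , q , p≢q , a≢p , a≢q = p , q , p≢q , trans (B≗complete a p) (completeAdj-≢ a≢p)
                                             , trans (B≗complete a q) (completeAdj-≢ a≢q)

Built⇒2≤n : ∀ {n B} → Built n B → 2 ≤ n
Built⇒2≤n (base j)     = s≤s (s≤s z≤n)
Built⇒2≤n (glue j b a) = ≤-trans (Built⇒2≤n b) (m≤m+n _ _)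

another-vertex : ∀ {n} → 2 ≤ n → (a : Fin n) → ∃[ b ] b ≢ a
another-vertex (s≤s (s≤s _)) zero    = suc zero , λ ()
another-vertex (s≤s (s≤s _)) (suc a) = zero , λ ()

Built-classification : ∀ {n B} → Built n B → CutWitness B ⊎ PathShaped B ⊎ LargeComplete B
Built-classification (base zero)    = inj₂ (inj₁ (id , λ { zero zero → refl ; zero (suc zero) → refl
                                                         ; (suc zero) zero → refl ; (suc zero) (suc zero) → refl }))
Built-classification (base (suc j)) = inj₂ (inj₂ (s≤s (s≤s (s≤s z≤n)) , λ _ _ → refl))
Built-classification (glue (suc j) b a) =
  let (c , c≢a) = another-vertex (Built⇒2≤n b) a in inj₁ (CutWitness-large-block j _ a c c≢a)
Built-classification (glue zero b a) with Built-classification b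
... | inj₁ cw                    = inj₁ (Glue.CutWitness-lift zero _ a cw)
... | inj₂ (inj₁ (σ , iso))      = map₂ inj₁ (PathShaped-glue-leaf σ iso a)
... | inj₂ (inj₂ large-complete) =
      inj₁ (Glue.CutWitness-at-two-neighbours zero _ a (LargeComplete⇒TwoNeighbours large-complete a))

CutWitness-transport : ∀ {n} {A B : Fin n → Fin n → Bool} (σ : Permutation′ n) →
                       (∀ x y → A x y ≡ B (σ ⟨$⟩ʳ x) (σ ⟨$⟩ʳ y)) → CutWitness B → CutWitness A
CutWitness-transport {A = A} {B} σ iso
  record { cut = c ; v = v ; v′ = v′ ; w = w ; v≢v′ = v≢v′ ; cut~v = c~v ; cut~v′ = c~v′
         ; w≢cut = w≢c ; w↛v = w↛v ; w↛v′ = w↛v′ } = record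
  { cut = σ ⟨$⟩ˡ c ; v = σ ⟨$⟩ˡ v ; v′ = σ ⟨$⟩ˡ v′ ; w = σ ⟨$⟩ˡ w
  ; v≢v′   = v≢v′ ∘ ⟨$⟩ˡ-injective σ
  ; cut~v  = edge c~v
  ; cut~v′ = edge c~v′
  ; w≢cut  = w≢c ∘ ⟨$⟩ˡ-injective σ
  ; w↛v    = λ r → w↛v (subst₂ (Reach _ (_≢ c)) (inverseʳ σ) (inverseʳ σ) (push r))
  ; w↛v′   = λ r → w↛v′ (subst₂ (Reach _ (_≢ c)) (inverseʳ σ) (inverseʳ σ) (push r))
  }
  where
  edge : ∀ {x y} → B x y ≡ true → A (σ ⟨$⟩ˡ x) (σ ⟨$⟩ˡ y) ≡ true
  edge {x} {y} e = trans (iso _ _) (trans (cong₂ B (inverseʳ σ) (inverseʳ σ)) e)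
  push : ∀ {x y} → Reach A (_≢ σ ⟨$⟩ˡ c) x y → Reach B (_≢ c) (σ ⟨$⟩ʳ x) (σ ⟨$⟩ʳ y)
  push = Reach-map (σ ⟨$⟩ʳ_) (λ {x} {y} e → inj₂ (trans (≡-sym (iso x y)) e))
                   (λ x≢ e → x≢ (trans (≡-sym (inverseˡ σ)) (cong (σ ⟨$⟩ˡ_) e)))

Edge⇒Dist1 : ∀ {n} (G : Graph n) {u x} → Edge G u x → Dist G u x 1
Edge⇒Dist1 G {u} e = cons tt e (nil tt) , shorter
  where
  shorter : ∀ k → k < 1 → ¬ Walk G u _ k
  shorter zero _ (nil _) = Edge⇒≢ G e refl
  shorter (suc k) (s≤s ()) _

CutWitness⇒PNonempty : ∀ {n} (G : Graph n) → CutWitness (Adj G) → PNonempty G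
CutWitness⇒PNonempty G record { cut = c ; v = v ; v′ = v′ ; w = w ; v≢v′ = v≢v′ ; cut~v = c~v ; cut~v′ = c~v′
                              ; w≢cut = w≢c ; w↛v = w↛v ; w↛v′ = w↛v′ } =
  v , v′ , v≢v′ , 1 , s≤s z≤n , ⁅ c ⁆ , on-spheres
    , (w , v , ≢⇒∉ w≢c , ≢⇒∉ (Edge⇒≢ G c~v ∘ ≡-sym) , separated w↛v)
    , (w , ≢⇒∉ w≢c , separated w↛v , separated w↛v′)
  where
  ≢⇒∉ : ∀ {x} → x ≢ c → x ∉ ⁅ c ⁆
  ≢⇒∉ x≢c x∈ = x≢c (x∈⁅y⁆⇒x≡y c x∈)
  ∉⇒≢ : ∀ {x} → x ∉ ⁅ c ⁆ → x ≢ c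
  ∉⇒≢ x∉ refl = x∉ (x∈⁅x⁆ c)
  on-spheres : ∀ x → x ∈ ⁅ c ⁆ → InSphere G v 1 x × InSphere G v′ 1 x
  on-spheres x x∈ with x∈⁅y⁆⇒x≡y c x∈
  ... | refl = Edge⇒Dist1 G (Edge-sym G c~v) , Edge⇒Dist1 G (Edge-sym G c~v′)
  separated : ∀ {y} → ¬ Reach (Adj G) (_≢ c) w y → ¬ ConnectedAvoiding G ⁅ c ⁆ w y
  separated w↛y (_ , walk) = w↛y (Reach-map (λ x → x) inj₂ ∉⇒≢ (WalkIn⇒Reach walk))

complete⇒¬VertexSeparator : ∀ {n} (G : Graph n) → IsComplete G → ∀ S → ¬ VertexSeparator G S
complete⇒¬VertexSeparator G complete S (u , w , u∉S , w∉S , u↛w) with u ≟ w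
... | yes refl = u↛w (0 , nil u∉S)
... | no u≢w   = u↛w (1 , cons u∉S (complete u w u≢w) (nil w∉S))

IsoToAdj-trans : ∀ {n} {G : Graph n} {B C : Fin n → Fin n → Bool} → IsoToAdj G B →
                 (τ : Permutation′ n) → (∀ x y → B x y ≡ C (τ ⟨$⟩ʳ x) (τ ⟨$⟩ʳ y)) → IsoToAdj G C
IsoToAdj-trans (σ , iso) τ iso′ = σ ∘ₚ τ , λ u v → trans (iso u v) (iso′ (σ ⟨$⟩ʳ u) (σ ⟨$⟩ʳ v))

IsoToAdj-complete : ∀ {n} (G : Graph n) → IsoToAdj G completeAdj → IsComplete G
IsoToAdj-complete G (σ , iso) u v u≢v =
  trans (iso u v) (completeAdj-≢ (u≢v ∘ ⟨$⟩ʳ-injective σ))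

proposition3p14 : ∀ {n : ℕ} (G : Graph n) → Connected G → IsBlockGraph G →
    (PNonempty G ⇔ NonElementary G)
proposition3p14 G _ (B , built , σ , iso) = mk⇔ PNonempty⇒NonElementary NonElementary⇒PNonempty
  where
  PNonempty⇒NonElementary : PNonempty G → NonElementary G
  PNonempty⇒NonElementary P@(_ , _ , _ , _ , _ , S , _ , separator , _) =
    (λ complete → complete⇒¬VertexSeparator G complete S separator) ,
    (λ (τ , isoτ) → PathGraph.P-empty G τ isoτ P)
  NonElementary⇒PNonempty : NonElementary G → PNonempty G
  NonElementary⇒PNonempty (¬complete , ¬path) with Built-classification built
  ... | inj₁ cw                      = CutWitness⇒PNonempty G (CutWitness-transport σ iso cw)
  ... | inj₂ (inj₁ (τ , isoτ))       = ⊥-elim (¬path (IsoToAdj-trans {G = G} {C = pathAdj} (σ , iso) τ isoτ))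
  ... | inj₂ (inj₂ (_ , B≗complete)) =
        ⊥-elim (¬complete (IsoToAdj-complete G (IsoToAdj-trans {G = G} {C = completeAdj} (σ , iso) id B≗complete)))
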